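{- Let $n\ge1$ and $(m_1,\dots,m_n)$ be a sequence of positive integers. Then the length of the bottom row of any lps tableau over $\mathcal{A}_n$ with evaluation $(m_1,\dots,m_n)$ is at least $\max\{m_1,\dots,m_n\}$ and at most $m_1+\cdots+m_n$.
   Context: $\mathcal{A}_n=\{1<2<\cdots<n\}$. A composition diagram is a finite left-to-right sequence of nonempty bottom-justified columns of boxes; the bottom row consists of the lowest box of each column, and its length is the number of columns. An lps tableau over $\mathcal{A}_n$ is a filling of a composition diagram by elements of $\mathcal{A}_n$ such that each column is strictly increasing from bottom to top and the bottom row is weakly increasing from left to right. It has evaluation $(m_1,\dots,m_n)$ if each symbol $a$ occurs exactly $m_a$ times. -}

module Defs where

open import Data.Nat using (ℕ; suc; _≤_; _<_)
open import Data.Fin using (Fin; _≟_)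
import Data.Fin as F
open import Data.List using (List; []; _∷_; length; map; concat; filter; tabulate)
open import Data.Nat.ListAction using (sum)
open import Data.List.Relation.Unary.All using (All)
open import Relation.Binary.PropositionalEquality using (_≡_)
open import Data.List.Relation.Unary.Linked using (Linked)
open import Data.Vec.Functional using (Vector)
open import Data.Product using (Σ; _×_; _,_)

-- The alphabet A_n = {1 < ... < n} is modelled by Fin n with its usual order.

-- A column of boxes, listed from bottom to top; it must be nonempty.
-- A column is given as its bottom entry together with the entries above it.
record Column (n : ℕ) : Set where
  constructor col
  field
    bottom : Fin n
    above  : List (Fin n)

open Column public

entries : ∀ {n} → Column n → List (Fin n)
entries (col b as) = b ∷ as

StrictCol : ∀ {n} → Column n → Set
StrictCol c = Linked F._<_ (entries c)

-- A filling of a composition diagram: a left-to-right list of (nonempty) columns.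
Filling : ℕ → Set
Filling n = List (Column n)

bottomRow : ∀ {n} → Filling n → List (Fin n)
bottomRow = map bottom

IsLPS : ∀ {n} → Filling n → Set
IsLPS T = All StrictCol T × Linked F._≤_ (bottomRow T)

count : ∀ {n} → Fin n → Filling n → ℕ
count a T = length (filter (_≟ a) (concat (map entries T)))

HasEvaluation : ∀ {n} → Filling n → Vector ℕ n → Set
HasEvaluation {n} T m = (a : Fin n) → count a T ≡ m a

sumEval : ∀ {n} → Vector ℕ n → ℕ
sumEval {n} m = sum (tabulate m)

-- Each symbol occurs at most once in a strictly increasing column, so at most
-- once per column: m_a is at most the number of columns, i.e. the length of the
-- bottom row.  Each column is nonempty, so there are at most as many columns as
-- boxes, and there are m_1 + ⋯ + m_n boxes.
module Submission where

open import Defs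
import Data.Nat as ℕ
open import Data.Nat using (ℕ; _≤_; _+_; z≤n; s≤s)
open import Data.Nat.Properties
  using (+-mono-≤; m≤n+m; +-0-commutativeMonoid; module ≤-Reasoning)
open import Data.Fin using (Fin; zero; suc; _≟_)
import Data.Fin as F
open import Data.Fin.Properties using (<⇒≢; <-trans)
open import Data.List using (List; []; _∷_; [_]; _++_; length; map; concat; filter; tabulate)
open import Data.List.Properties using (length-++; length-map; filter-++)
open import Data.Nat.ListAction using (sum)
open import Data.List.Relation.Unary.All using (All; []; _∷_)
open import Data.List.Relation.Unary.All.Properties using (all-filter)
import Data.List.Relation.Unary.AllPairs as AllPairs
open import Data.List.Relation.Unary.Linked using (Linked)
open import Data.List.Relation.Unary.Linked.Properties using (Linked⇒AllPairs)
open import Data.List.Relation.Unary.Unique.Propositional using (Unique; []; _∷_)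
import Data.List.Relation.Unary.Unique.Propositional.Properties as Unique
open import Data.Vec.Functional using (Vector)
open import Algebra.Properties.CommutativeMonoid.Sum +-0-commutativeMonoid
  using (sum-syntax; ∑-distrib-+; sum-cong-≗; sum-replicate-zero)
  renaming (sum to ∑)
open import Data.Product using (_×_; _,_)
open import Relation.Binary.PropositionalEquality using (_≡_; refl; trans; cong; cong₂; module ≡-Reasoning)
open import Data.Empty using (⊥-elim)
open import Relation.Nullary using (yes; no)

occurrences : ∀ {n} → Fin n → List (Fin n) → ℕ
occurrences a xs = length (filter (_≟ a) xs)

occurrences-++ : ∀ {n} (a : Fin n) xs ys →
                 occurrences a (xs ++ ys) ≡ occurrences a xs + occurrences a ys
occurrences-++ a xs ys = begin
  length (filter (_≟ a) (xs ++ ys))             ≡⟨ cong length (filter-++ (_≟ a) xs ys) ⟩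
  length (filter (_≟ a) xs ++ filter (_≟ a) ys) ≡⟨ length-++ (filter (_≟ a) xs) ⟩
  occurrences a xs + occurrences a ys           ∎
  where open ≡-Reasoning

Unique∧All≡⇒length≤1 : ∀ {A : Set} {a : A} {xs : List A} →
                       Unique xs → All (_≡ a) xs → length xs ≤ 1
Unique∧All≡⇒length≤1 []              []                = z≤n
Unique∧All≡⇒length≤1 (_ ∷ [])        (_ ∷ [])          = s≤s z≤n
Unique∧All≡⇒length≤1 ((x≢y ∷ _) ∷ _) (refl ∷ refl ∷ _) = ⊥-elim (x≢y refl)

Unique⇒occurrences≤1 : ∀ {n} (a : Fin n) {xs} → Unique xs → occurrences a xs ≤ 1
Unique⇒occurrences≤1 a {xs} u =
  Unique∧All≡⇒length≤1 (Unique.filter⁺ (_≟ a) u) (all-filter (_≟ a) xs)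

strictlyIncreasing⇒Unique : ∀ {n} {xs : List (Fin n)} → Linked F._<_ xs → Unique xs
strictlyIncreasing⇒Unique l = AllPairs.map <⇒≢ (Linked⇒AllPairs <-trans l)

count≤columns : ∀ {n} (a : Fin n) (T : Filling n) → All StrictCol T → count a T ≤ length T
count≤columns a []      []       = z≤n
count≤columns a (c ∷ T) (s ∷ ss) = begin
  count a (c ∷ T)                                         ≡⟨ occurrences-++ a (entries c) (concat (map entries T)) ⟩
  occurrences a (entries c) + count a T                   ≤⟨ +-mono-≤ (Unique⇒occurrences≤1 a (strictlyIncreasing⇒Unique s))
                                                                      (count≤columns a T ss) ⟩
  1 + length T                                            ∎
  where open ≤-Reasoning

columns≤boxes : ∀ {n} (T : Filling n) → length T ≤ length (concat (map entries T))
columns≤boxes []             = z≤n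
columns≤boxes (col _ as ∷ T) = s≤s (begin
  length T                                    ≤⟨ columns≤boxes T ⟩
  length (concat (map entries T))             ≤⟨ m≤n+m _ (length as) ⟩
  length as + length (concat (map entries T)) ≡⟨ length-++ as ⟨
  length (as ++ concat (map entries T))       ∎)
  where open ≤-Reasoning

-- Not definitional: filter is stuck on x ≟ a rather than on suc x ≟ suc a.
occurrences-suc-singleton : ∀ {n} (x a : Fin n) → occurrences (suc a) [ suc x ] ≡ occurrences a [ x ]
occurrences-suc-singleton x a with x ≟ a
... | yes _ = refl
... | no  _ = refl

∑-occurrences-singleton : ∀ {n} (x : Fin n) → ∑[ a < n ] occurrences a [ x ] ≡ 1
∑-occurrences-singleton {ℕ.suc n} zero    = cong ℕ.suc (sum-replicate-zero n)
∑-occurrences-singleton {ℕ.suc n} (suc x) =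
  trans (sum-cong-≗ (λ a → occurrences-suc-singleton x a)) (∑-occurrences-singleton x)

∑-occurrences : ∀ {n} (xs : List (Fin n)) → ∑[ a < n ] occurrences a xs ≡ length xs
∑-occurrences {n} []       = sum-replicate-zero n
∑-occurrences {n} (x ∷ xs) = begin
  ∑[ a < n ] occurrences a (x ∷ xs)                               ≡⟨ sum-cong-≗ (λ a → occurrences-++ a [ x ] xs) ⟩
  ∑[ a < n ] (occurrences a [ x ] + occurrences a xs)             ≡⟨ ∑-distrib-+ (λ a → occurrences a [ x ]) (λ a → occurrences a xs) ⟩
  ∑[ a < n ] occurrences a [ x ] + ∑[ a < n ] occurrences a xs    ≡⟨ cong₂ _+_ (∑-occurrences-singleton x) (∑-occurrences xs) ⟩
  ℕ.suc (length xs)                                               ∎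
  where open ≡-Reasoning

sum-tabulate : ∀ {n} (f : Vector ℕ n) → sum (tabulate f) ≡ ∑ f
sum-tabulate {ℕ.zero}  f = refl
sum-tabulate {ℕ.suc n} f = cong (f zero +_) (sum-tabulate (λ i → f (suc i)))

lemma4p1 : (n : ℕ) → 1 ≤ n → (m : Vector ℕ n) → ((a : Fin n) → 1 ≤ m a) →
    (T : Filling n) → IsLPS T → HasEvaluation T m →
    ((a : Fin n) → m a ≤ length (bottomRow T)) × length (bottomRow T) ≤ sumEval m
lemma4p1 n _ m _ T (strictCols , _) eval = lower , upper
  where
  open ≤-Reasoning

  lower : (a : Fin n) → m a ≤ length (bottomRow T)
  lower a = begin
    m a                   ≡⟨ eval a ⟨
    count a T             ≤⟨ count≤columns a T strictCols ⟩
    length T              ≡⟨ length-map bottom T ⟨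
    length (bottomRow T)  ∎

  upper : length (bottomRow T) ≤ sumEval m
  upper = begin
    length (bottomRow T)                     ≡⟨ length-map bottom T ⟩
    length T                                 ≤⟨ columns≤boxes T ⟩
    length (concat (map entries T))          ≡⟨ ∑-occurrences (concat (map entries T)) ⟨
    ∑[ a < n ] count a T                     ≡⟨ sum-cong-≗ eval ⟩
    ∑ m                                      ≡⟨ sum-tabulate m ⟨
    sumEval m                                ∎
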